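{- Let $n\ge1$ and $k$ be integers with $\lfloor\frac{n+1}{2}\rfloor\le k\le n$. (a) The map $\phi$ is a sign-reversing involution on $A_{n,k}$. (b) If $n$ is odd, then $|A^*_{n,k}|=b\!\left(\frac{n-1}{2},\frac{k-1}{2}\right)$ if $k$ is odd, and $|A^*_{n,k}|=0$ if $k$ is even. (c) If $n$ is even, then $|A^*_{n,k}|=b\!\left(\frac{n}{2}-1,\left\lfloor\frac{k-1}{2}\right\rfloor\right)$.
   Context: A ballot sequence of length $n$ is a sequence $b_1b_2\cdots b_n$ with each $b_i\in\{1,-1\}$ and $b_1+\dots+b_j\ge0$ for all $j$. The sign of a ballot sequence $b$ is $1$ if the sum of all positions $i$ with $b_i=-1$ is even, and $-1$ otherwise. For a ballot sequence $b$ of length $n$, $\varepsilon(b)$ is the smallest even integer $i$ with $1\le i\le n-1$ and $b_i=-b_{i+1}$, and $\varepsilon(b)=0$ if there is no such $i$. $A_{n,k}$ is the set of ballot sequences of length $n$ with exactly $k$ entries equal to $1$ and $\varepsilon(b)>0$; $A^*_{n,k}$ is the set of such sequences with $\varepsilon(b)=0$. For $b\in A_{n,k}$ with $\varepsilon(b)=j$, $\phi(b)$ is the sequence obtained from $b$ by exchanging $b_j$ and $b_{j+1}$. Sign-reversing means the sign of $\phi(b)$ is the negative of the sign of $b$. The ballot number is $b(N,K)=\frac{2K-N+1}{N+1}\binom{N+1}{K+1}$. -}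

module Defs where

open import Data.Bool using (Bool; true; false; _∧_; if_then_else_)
open import Data.Nat as ℕ using (ℕ; zero; suc; _∸_; _<_; _≟_; _%_)
import Data.Nat.Properties as ℕP
open import Data.Nat.Combinatorics using (_C_)
open import Data.Integer as ℤ using (ℤ; +_; -[1+_])
import Data.Integer.Properties as ℤP
open import Data.Rational as ℚ using (ℚ)
open import Data.Fin using (Fin; toℕ)
open import Data.Fin.Properties using (all?)
open import Data.Vec as Vec using (Vec; []; _∷_; lookup)
open import Data.List as List using (List; []; _∷_; length; filter; map; concatMap)
open import Data.Nat.ListAction using (sum)
open import Data.Maybe using (Maybe; just; nothing)
open import Data.Product using (_×_; _,_)
open import Relation.Binary.PropositionalEquality using (_≡_)
open import Relation.Nullary using (Dec; yes; no)
open import Relation.Nullary.Decidable using (_×-dec_; ⌊_⌋)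

data PM : Set where
  p1 m1 : PM

val : PM → ℤ
val p1 = + 1
val m1 = -[1+ 0 ]

neg : PM → PM
neg p1 = m1
neg m1 = p1

_≟PM_ : (x y : PM) → Dec (x ≡ y)
p1 ≟PM p1 = yes _≡_.refl
m1 ≟PM m1 = yes _≡_.refl
p1 ≟PM m1 = no (λ ())
m1 ≟PM p1 = no (λ ())

-- Sequences b = b_1 ... b_n, stored as vectors (entry b_i is at Fin index i-1).
Seq : ℕ → Set
Seq n = Vec PM n

psum : ∀ {n} → ℕ → Seq n → ℤ
psum j b = List.foldr ℤ._+_ (+ 0) (List.map val (List.take j (Vec.toList b)))

IsBallot : ∀ {n} → Seq n → Set
IsBallot {n} b = (j : Fin (suc n)) → + 0 ℤ.≤ psum (toℕ j) b

isBallot? : ∀ {n} (b : Seq n) → Dec (IsBallot b)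
isBallot? b = all? (λ j → + 0 ℤ.≤? psum (toℕ j) b)

numPlus : ∀ {n} → Seq n → ℕ
numPlus [] = 0
numPlus (p1 ∷ b) = suc (numPlus b)
numPlus (m1 ∷ b) = numPlus b

-- 1-based entry access: entry b i = b_i (nothing if i = 0 or i > n)
entry : ∀ {n} → Seq n → ℕ → Maybe PM
entry [] _ = nothing
entry (x ∷ b) zero = nothing
entry (x ∷ b) (suc zero) = just x
entry (x ∷ b) (suc (suc i)) = entry b (suc i)

oppAt : ∀ {n} → Seq n → ℕ → Bool
oppAt b i with entry b i | entry b (suc i)
... | just x | just y = ⌊ x ≟PM neg y ⌋
... | _ | _ = false

isEven : ℕ → Bool
isEven i = ⌊ i % 2 ≟ 0 ⌋

firstOr0 : (ℕ → Bool) → List ℕ → ℕ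
firstOr0 t [] = 0
firstOr0 t (i ∷ is) = if t i then i else firstOr0 t is

-- ε(b): the smallest even i with 1 ≤ i ≤ n-1 and b_i = -b_{i+1}; 0 if none
eps : ∀ {n} → Seq n → ℕ
eps {n} b = firstOr0 (λ i → isEven i ∧ oppAt b i) (List.applyUpTo suc (n ∸ 1))

-- exchange b_j and b_{j+1} (1-based j; identity if j = 0 or j ≥ n)
swapAt : ∀ {n} → ℕ → Seq n → Seq n
swapAt zero b = b
swapAt (suc zero) (x ∷ y ∷ b) = y ∷ x ∷ b
swapAt (suc zero) b = b
swapAt (suc (suc j)) [] = []
swapAt (suc (suc j)) (x ∷ b) = x ∷ swapAt (suc j) b

phi : ∀ {n} → Seq n → Seq n
phi b = swapAt (eps b) b

negPosSum : ∀ {n} → Seq n → ℕ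
negPosSum {n} b = sum (List.map (λ (i : Fin n) → posIf (lookup b i) (suc (toℕ i))) (List.allFin n))
  where
  posIf : PM → ℕ → ℕ
  posIf p1 _ = 0
  posIf m1 i = i

sgn : ∀ {n} → Seq n → ℤ
sgn b = if isEven (negPosSum b) then + 1 else -[1+ 0 ]

InA : (n k : ℕ) → Seq n → Set
InA n k b = IsBallot b × numPlus b ≡ k × 0 < eps b

InAstar : (n k : ℕ) → Seq n → Set
InAstar n k b = IsBallot b × numPlus b ≡ k × eps b ≡ 0

inAstar? : (n k : ℕ) (b : Seq n) → Dec (InAstar n k b)
inAstar? n k b = isBallot? b ×-dec (numPlus b ≟ k ×-dec (eps b ≟ 0))

allSeqs : (n : ℕ) → List (Seq n)
allSeqs zero = [] ∷ []
allSeqs (suc n) = concatMap (λ b → (p1 ∷ b) ∷ (m1 ∷ b) ∷ []) (allSeqs n)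

cardAstar : ℕ → ℕ → ℕ
cardAstar n k = length (filter (inAstar? n k) (allSeqs n))

ballotNum : ℕ → ℕ → ℚ
ballotNum N K = ((+ (2 ℕ.* K) ℤ.- + N ℤ.+ + 1) ℚ./ suc N) ℚ.* ((+ (suc N C suc K)) ℚ./ 1)

toℚ : ℕ → ℚ
toℚ m = + m ℚ./ 1

{-# OPTIONS --safe #-}
-- A sequence in A_{n,k} starts with 1, and from b₂ on it is read in consecutive pairs
-- (b₂,b₃), (b₄,b₅), …; ε(b) is the start of the first mixed pair, i.e. one with distinct
-- entries. Exchanging that pair leaves it the first mixed pair, so φ is an involution; it keeps
-- the number of 1s; it moves one -1 by one place, so the sign changes; and it keeps the ballot
-- condition, since the partial sum before each pair is odd. The fixed points A*_{n,k} are 1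
-- followed by equal pairs (plus a free last entry when n is even, the height before it being
-- odd). Halving the pairs gives the ballot paths of length m = ⌊(n-1)/2⌋ with K = ⌊(k-1)/2⌋
-- up-steps, counted by the reflection principle as C(m,K) - C(m,K+1) = b(m,K).
module Submission where

open import Defs
open import Data.Nat using (ℕ; _≤_; _%_; _/_; _∸_; _+_)
open import Data.Integer using (-_)
open import Data.Product using (_×_)
open import Relation.Binary.PropositionalEquality using (_≡_)

open import Data.Bool using (Bool; true; false; not; if_then_else_; _∧_)
open import Data.Empty using (⊥; ⊥-elim)
open import Data.Fin using (Fin; zero; suc; toℕ)
open import Data.Integer as ℤ using (ℤ; +_; -[1+_]; +≤+)
import Data.Integer.Properties as ℤ
open import Data.Integer.Tactic.RingSolver using (solve-∀)
open import Data.List as List using ([]; _∷_; length; filter; concatMap; tabulate; allFin; applyUpTo)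
open import Data.List.Properties using (filter-≐; filter-none; map-tabulate; tabulate-cong)
open import Data.List.Relation.Unary.All using (universal)
open import Data.Maybe using (Maybe; just; nothing)
open import Data.Nat as ℕ using (zero; suc; z≤n; s≤s; _<_; _*_)
import Data.Nat.Properties as ℕ
open import Algebra.Properties.CommutativeSemigroup ℕ.+-commutativeSemigroup
  using (interchange; x∙yz≈y∙xz)
open import Data.Nat.Combinatorics using (_C_; k>n⇒nCk≡0; nC1≡n)
  renaming (nCk+nC[k+1]≡[n+1]C[k+1] to pascal)
open import Data.Nat.DivMod using (m/n≡1+[m∸n]/n)
open import Data.Nat.ListAction using (sum)
open import Data.Product as Product using (Σ; _,_; proj₁; proj₂)
import Data.Rational as ℚ
import Data.Rational.Properties as ℚ
open import Data.Rational.Unnormalised using (mkℚᵘ; *≡*)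
import Data.Rational.Unnormalised.Properties as ℚᵘ
open import Data.Sum using (_⊎_; inj₁; inj₂)
open import Data.Unit using (⊤; tt)
open import Data.Vec using ([]; _∷_; lookup)
open import Function using (_∘_; _∘′_)
open import Relation.Binary.PropositionalEquality
  using (refl; sym; trans; cong; cong₂; subst; module ≡-Reasoning)
open import Relation.Nullary using (yes; no; ¬_)
open import Relation.Nullary.Decidable using (⌊_⌋; _×-dec_)
open import Relation.Unary using (Decidable)

open ≡-Reasoning

private
  variable
    m n e : ℕ

-- Halving

double : ℕ → ℕ
double zero    = zero
double (suc n) = suc (suc (double n))

data EvenOdd : ℕ → Set where
  even : ∀ m → EvenOdd (double m)
  odd  : ∀ m → EvenOdd (suc (double m))

evenOdd : ∀ n → EvenOdd n
evenOdd zero          = even zero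
evenOdd (suc zero)    = odd zero
evenOdd (suc (suc n)) with evenOdd n
... | even m = even (suc m)
... | odd  m = odd (suc m)

double[m]%2≡0 : ∀ m → double m % 2 ≡ 0
double[m]%2≡0 zero    = refl
double[m]%2≡0 (suc m) = double[m]%2≡0 m

[1+double[m]]%2≡1 : ∀ m → suc (double m) % 2 ≡ 1
[1+double[m]]%2≡1 zero    = refl
[1+double[m]]%2≡1 (suc m) = [1+double[m]]%2≡1 m

[2+n]/2≡1+n/2 : ∀ n → (2 + n) / 2 ≡ suc (n / 2)
[2+n]/2≡1+n/2 n = m/n≡1+[m∸n]/n {2 + n} {2} (s≤s (s≤s z≤n))

double[m]/2≡m : ∀ m → double m / 2 ≡ m
double[m]/2≡m zero    = refl
double[m]/2≡m (suc m) = trans ([2+n]/2≡1+n/2 (double m)) (cong suc (double[m]/2≡m m))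

[1+double[m]]/2≡m : ∀ m → suc (double m) / 2 ≡ m
[1+double[m]]/2≡m zero    = refl
[1+double[m]]/2≡m (suc m) =
  trans ([2+n]/2≡1+n/2 (suc (double m))) (cong suc ([1+double[m]]/2≡m m))

n≤1+double[n/2] : ∀ n → n ≤ suc (double (n / 2))
n≤1+double[n/2] zero          = z≤n
n≤1+double[n/2] (suc zero)    = s≤s z≤n
n≤1+double[n/2] (suc (suc n)) rewrite [2+n]/2≡1+n/2 n = s≤s (s≤s (n≤1+double[n/2] n))

[n+1]/2≡[1+n]/2 : ∀ n → (n + 1) / 2 ≡ suc n / 2
[n+1]/2≡[1+n]/2 n = cong (_/ 2) (ℕ.+-comm n 1)

[1+double[m]+1]/2≡1+m : ∀ m → (suc (double m) + 1) / 2 ≡ suc m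
[1+double[m]+1]/2≡1+m m = trans ([n+1]/2≡[1+n]/2 (suc (double m))) (double[m]/2≡m (suc m))

[double[1+m]+1]/2≡1+m : ∀ m → (double (suc m) + 1) / 2 ≡ suc m
[double[1+m]+1]/2≡1+m m = trans ([n+1]/2≡[1+n]/2 (double (suc m))) ([1+double[m]]/2≡m (suc m))

-- Ballot condition

BallotFrom : ℕ → Seq n → Set
BallotFrom h       []       = ⊤
BallotFrom h       (p1 ∷ b) = BallotFrom (suc h) b
BallotFrom zero    (m1 ∷ b) = ⊥
BallotFrom (suc h) (m1 ∷ b) = BallotFrom h b

ballotFrom? : ∀ h → Decidable (BallotFrom {n} h)
ballotFrom? h       []       = yes tt
ballotFrom? h       (p1 ∷ b) = ballotFrom? (suc h) b
ballotFrom? zero    (m1 ∷ b) = no λ ()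
ballotFrom? (suc h) (m1 ∷ b) = ballotFrom? h b

IsBallotFrom : ℤ → Seq n → Set
IsBallotFrom {n} z b = (j : Fin (suc n)) → + 0 ℤ.≤ z ℤ.+ psum (toℕ j) b

IsBallotFrom-∷⁻ : ∀ z x (b : Seq n) →
  IsBallotFrom z (x ∷ b) → + 0 ℤ.≤ z × IsBallotFrom (z ℤ.+ val x) b
IsBallotFrom-∷⁻ z x b H =
  subst (+ 0 ℤ.≤_) (ℤ.+-identityʳ z) (H zero) ,
  λ j → subst (+ 0 ℤ.≤_) (sym (ℤ.+-assoc z (val x) _)) (H (suc j))

IsBallotFrom-∷⁺ : ∀ z x (b : Seq n) →
  + 0 ℤ.≤ z → IsBallotFrom (z ℤ.+ val x) b → IsBallotFrom z (x ∷ b)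
IsBallotFrom-∷⁺ z x b 0≤z H zero    = subst (+ 0 ℤ.≤_) (sym (ℤ.+-identityʳ z)) 0≤z
IsBallotFrom-∷⁺ z x b 0≤z H (suc j) = subst (+ 0 ℤ.≤_) (ℤ.+-assoc z (val x) _) (H j)

BallotFrom⇒IsBallotFrom : ∀ h (b : Seq n) → BallotFrom h b → IsBallotFrom (+ h) b
BallotFrom⇒IsBallotFrom h       []       _ zero = +≤+ z≤n
BallotFrom⇒IsBallotFrom h       (p1 ∷ b) B =
  IsBallotFrom-∷⁺ (+ h) p1 b (+≤+ z≤n) (subst (λ z → IsBallotFrom z b) (cong +_ (ℕ.+-comm 1 h))
    (BallotFrom⇒IsBallotFrom (suc h) b B))
BallotFrom⇒IsBallotFrom (suc h) (m1 ∷ b) B =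
  IsBallotFrom-∷⁺ (+ suc h) m1 b (+≤+ z≤n) (BallotFrom⇒IsBallotFrom h b B)

IsBallotFrom⇒BallotFrom : ∀ h (b : Seq n) → IsBallotFrom (+ h) b → BallotFrom h b
IsBallotFrom⇒BallotFrom h       []       _ = tt
IsBallotFrom⇒BallotFrom h       (p1 ∷ b) H =
  IsBallotFrom⇒BallotFrom (suc h) b (subst (λ z → IsBallotFrom z b) (cong +_ (ℕ.+-comm h 1))
    (proj₂ (IsBallotFrom-∷⁻ (+ h) p1 b H)))
IsBallotFrom⇒BallotFrom zero    (m1 ∷ b) H with proj₂ (IsBallotFrom-∷⁻ (+ 0) m1 b H) zero
... | ()
IsBallotFrom⇒BallotFrom (suc h) (m1 ∷ b) H =
  IsBallotFrom⇒BallotFrom h b (proj₂ (IsBallotFrom-∷⁻ (+ suc h) m1 b H))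

IsBallot⇒BallotFrom : (b : Seq n) → IsBallot b → BallotFrom 0 b
IsBallot⇒BallotFrom b H =
  IsBallotFrom⇒BallotFrom 0 b (λ j → subst (+ 0 ℤ.≤_) (sym (ℤ.+-identityˡ _)) (H j))

BallotFrom⇒IsBallot : (b : Seq n) → BallotFrom 0 b → IsBallot b
BallotFrom⇒IsBallot b B j = subst (+ 0 ℤ.≤_) (ℤ.+-identityˡ _) (BallotFrom⇒IsBallotFrom 0 b B j)

-- The first mixed pair

swapAt-involutive : ∀ j (b : Seq n) → swapAt j (swapAt j b) ≡ b
swapAt-involutive zero          b           = refl
swapAt-involutive (suc zero)    []          = refl
swapAt-involutive (suc zero)    (x ∷ [])    = refl
swapAt-involutive (suc zero)    (x ∷ y ∷ b) = refl
swapAt-involutive (suc (suc j)) []          = refl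
swapAt-involutive (suc (suc j)) (x ∷ b)     = cong (x ∷_) (swapAt-involutive (suc j) b)

numPlus-swapAt : ∀ j (b : Seq n) → numPlus (swapAt j b) ≡ numPlus b
numPlus-swapAt zero          b             = refl
numPlus-swapAt (suc zero)    []            = refl
numPlus-swapAt (suc zero)    (x ∷ [])      = refl
numPlus-swapAt (suc zero)    (p1 ∷ p1 ∷ b) = refl
numPlus-swapAt (suc zero)    (p1 ∷ m1 ∷ b) = refl
numPlus-swapAt (suc zero)    (m1 ∷ p1 ∷ b) = refl
numPlus-swapAt (suc zero)    (m1 ∷ m1 ∷ b) = refl
numPlus-swapAt (suc (suc j)) []            = refl
numPlus-swapAt (suc (suc j)) (p1 ∷ b)      = cong suc (numPlus-swapAt (suc j) b)
numPlus-swapAt (suc (suc j)) (m1 ∷ b)      = numPlus-swapAt (suc j) b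

-- 0 stands for "no mixed pair" and is not shifted.
shift₂ : ℕ → ℕ
shift₂ zero    = zero
shift₂ (suc j) = suc (suc (suc j))

-- pairEps w = ε(x ∷ w): the pairs of w are the pairs (b₂,b₃), (b₄,b₅), … of b = x ∷ w.
pairEps : Seq n → ℕ
pairEps []            = 0
pairEps (_ ∷ [])      = 0
pairEps (p1 ∷ m1 ∷ r) = 2
pairEps (m1 ∷ p1 ∷ r) = 2
pairEps (p1 ∷ p1 ∷ r) = shift₂ (pairEps r)
pairEps (m1 ∷ m1 ∷ r) = shift₂ (pairEps r)

oppEntries : Maybe PM → Maybe PM → Bool
oppEntries (just x) (just y) = ⌊ x ≟PM neg y ⌋
oppEntries _        _        = false

oppAt-entries : ∀ (b : Seq n) i → oppAt b i ≡ oppEntries (entry b i) (entry b (suc i))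
oppAt-entries b i with entry b i | entry b (suc i)
... | just x  | just y  = refl
... | just x  | nothing = refl
... | nothing | _       = refl

oppAt-∷∷ : ∀ x y (b : Seq n) i → oppAt (x ∷ y ∷ b) (3 + i) ≡ oppAt b (suc i)
oppAt-∷∷ x y b i = trans (oppAt-entries (x ∷ y ∷ b) (3 + i)) (sym (oppAt-entries b (suc i)))

firstOr0-shift₂ : (t t′ : ℕ → Bool) → (∀ i → t (3 + i) ≡ t′ (suc i)) → ∀ m (f : ℕ → ℕ) →
  firstOr0 t (applyUpTo (λ i → 3 + f i) m) ≡ shift₂ (firstOr0 t′ (applyUpTo (λ i → suc (f i)) m))
firstOr0-shift₂ t t′ t≡t′ zero    f = refl
firstOr0-shift₂ t t′ t≡t′ (suc m) f rewrite t≡t′ (f 0) with t′ (suc (f 0))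
... | true  = refl
... | false = firstOr0-shift₂ t t′ t≡t′ m (λ i → f (suc i))

eps-equalPair : ∀ x y (r : Seq n) → eps (x ∷ y ∷ y ∷ r) ≡ shift₂ (eps (y ∷ r))
eps-equalPair {n} x p1 r =
  firstOr0-shift₂ _ _ (λ i → cong (isEven (suc i) ∧_) (oppAt-∷∷ x p1 (p1 ∷ r) i)) n (λ i → i)
eps-equalPair {n} x m1 r =
  firstOr0-shift₂ _ _ (λ i → cong (isEven (suc i) ∧_) (oppAt-∷∷ x m1 (m1 ∷ r) i)) n (λ i → i)

eps-∷ : ∀ x (w : Seq n) → eps (x ∷ w) ≡ pairEps w
eps-∷ x []            = refl
eps-∷ x (y ∷ [])      = refl
eps-∷ x (p1 ∷ m1 ∷ r) = refl
eps-∷ x (m1 ∷ p1 ∷ r) = refl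
eps-∷ x (p1 ∷ p1 ∷ r) = trans (eps-equalPair x p1 r) (cong shift₂ (eps-∷ p1 r))
eps-∷ x (m1 ∷ m1 ∷ r) = trans (eps-equalPair x m1 r) (cong shift₂ (eps-∷ m1 r))

data FirstMixedPair : Seq m → ℕ → Set where
  p1m1 : (r : Seq m) → FirstMixedPair (p1 ∷ m1 ∷ r) 0
  m1p1 : (r : Seq m) → FirstMixedPair (m1 ∷ p1 ∷ r) 0
  pair : ∀ y {r : Seq m} {e} → FirstMixedPair r e → FirstMixedPair (y ∷ y ∷ r) (2 + e)

pairEps-FirstMixedPair : {w : Seq n} → FirstMixedPair w e → pairEps w ≡ 2 + e
pairEps-FirstMixedPair (p1m1 r)    = refl
pairEps-FirstMixedPair (m1p1 r)    = refl
pairEps-FirstMixedPair (pair p1 f) = cong shift₂ (pairEps-FirstMixedPair f)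
pairEps-FirstMixedPair (pair m1 f) = cong shift₂ (pairEps-FirstMixedPair f)

0<shift₂ : ∀ j → 0 < shift₂ j → 0 < j
0<shift₂ (suc j) _ = s≤s z≤n

firstMixedPair : (w : Seq n) → 0 < pairEps w → Σ ℕ (FirstMixedPair w)
firstMixedPair (p1 ∷ m1 ∷ r) _   = 0 , p1m1 r
firstMixedPair (m1 ∷ p1 ∷ r) _   = 0 , m1p1 r
firstMixedPair (p1 ∷ p1 ∷ r) pos =
  Product.map (λ e → 2 + e) (pair p1) (firstMixedPair r (0<shift₂ _ pos))
firstMixedPair (m1 ∷ m1 ∷ r) pos =
  Product.map (λ e → 2 + e) (pair m1) (firstMixedPair r (0<shift₂ _ pos))

FirstMixedPair-swapAt : {w : Seq n} → FirstMixedPair w e → FirstMixedPair (swapAt (suc e) w) e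
FirstMixedPair-swapAt (p1m1 r)   = m1p1 r
FirstMixedPair-swapAt (m1p1 r)   = p1m1 r
FirstMixedPair-swapAt (pair y f) = pair y (FirstMixedPair-swapAt f)

-- Before each pair the height is odd, so a mixed pair keeps the path at height ≥ 0 in either order.
BallotFrom-swapAt : ∀ g {w : Seq n} → FirstMixedPair w e →
  BallotFrom (suc (double g)) w → BallotFrom (suc (double g)) (swapAt (suc e) w)
BallotFrom-swapAt g       (p1m1 r)    B = B
BallotFrom-swapAt g       (m1p1 r)    B = B
BallotFrom-swapAt g       (pair p1 f) B = BallotFrom-swapAt (suc g) f B
BallotFrom-swapAt zero    (pair m1 f) ()
BallotFrom-swapAt (suc g) (pair m1 f) B = BallotFrom-swapAt g f B

-- Sign

negWeight : PM → ℕ → ℕ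
negWeight p1 _ = 0
negWeight m1 i = i

negPosSumFrom : ℕ → Seq n → ℕ
negPosSumFrom o []      = 0
negPosSumFrom o (x ∷ b) = negWeight x (suc o) + negPosSumFrom (suc o) b

-- The summand of negPosSum is local to its where-block; this Σ names it.
negPosSum-summand : (b : Seq n) → Σ (Fin n → ℕ) λ F → negPosSum b ≡ sum (List.map F (allFin n))
negPosSum-summand b = _ , refl

negPosSum-summand≗ : (b : Seq n) (i : Fin n) →
  proj₁ (negPosSum-summand b) i ≡ negWeight (lookup b i) (suc (toℕ i))
negPosSum-summand≗ b i with lookup b i
... | p1 = refl
... | m1 = refl

sum-negWeight : ∀ o (b : Seq n) →
  sum (tabulate (λ i → negWeight (lookup b i) (suc (o + toℕ i)))) ≡ negPosSumFrom o b
sum-negWeight o []      = refl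
sum-negWeight o (x ∷ b) = cong₂ _+_
  (cong (negWeight x ∘′ suc) (ℕ.+-identityʳ o))
  (trans (cong sum (tabulate-cong λ i → cong (negWeight (lookup b i) ∘′ suc) (ℕ.+-suc o (toℕ i))))
         (sum-negWeight (suc o) b))

negPosSum≡negPosSumFrom0 : (b : Seq n) → negPosSum b ≡ negPosSumFrom 0 b
negPosSum≡negPosSumFrom0 b = begin
  negPosSum b                                                  ≡⟨ proj₂ (negPosSum-summand b) ⟩
  sum (List.map F (allFin _))                                  ≡⟨ cong sum (map-tabulate (λ i → i) F) ⟩
  sum (tabulate F)
    ≡⟨ cong sum (tabulate-cong (negPosSum-summand≗ b)) ⟩
  sum (tabulate (λ i → negWeight (lookup b i) (suc (toℕ i))))  ≡⟨ sum-negWeight 0 b ⟩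
  negPosSumFrom 0 b                                            ∎
  where F = proj₁ (negPosSum-summand b)

OffByOne : ℕ → ℕ → Set
OffByOne m n = m ≡ suc n ⊎ n ≡ suc m

OffByOne-+ˡ : ∀ p {m n} → OffByOne m n → OffByOne (p + m) (p + n)
OffByOne-+ˡ p (inj₁ m≡1+n) = inj₁ (trans (cong (_+_ p) m≡1+n) (ℕ.+-suc p _))
OffByOne-+ˡ p (inj₂ n≡1+m) = inj₂ (trans (cong (_+_ p) n≡1+m) (ℕ.+-suc p _))

negPosSumFrom-swapAt : ∀ o {w : Seq n} → FirstMixedPair w e →
  OffByOne (negPosSumFrom o w) (negPosSumFrom o (swapAt (suc e) w))
negPosSumFrom-swapAt o (p1m1 r)   = inj₁ refl
negPosSumFrom-swapAt o (m1p1 r)   = inj₂ refl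
negPosSumFrom-swapAt o (pair y f) = OffByOne-+ˡ (negWeight y (suc o))
  (OffByOne-+ˡ (negWeight y (2 + o)) (negPosSumFrom-swapAt (2 + o) f))

signOf : ℕ → ℤ
signOf m = if isEven m then + 1 else -[1+ 0 ]

isEven-suc : ∀ m → isEven (suc m) ≡ not (isEven m)
isEven-suc zero          = refl
isEven-suc (suc zero)    = refl
isEven-suc (suc (suc m)) = isEven-suc m

signOf-suc : ∀ m → signOf (suc m) ≡ - signOf m
signOf-suc m rewrite isEven-suc m with isEven m
... | true  = refl
... | false = refl

signOf-OffByOne : ∀ {m n} → OffByOne m n → signOf n ≡ - signOf m
signOf-OffByOne {m}     (inj₂ refl) = signOf-suc m
signOf-OffByOne {n = n} (inj₁ refl) =
  trans (sym (ℤ.neg-involutive (signOf n))) (cong -_ (sym (signOf-suc n)))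

sgn-swapAt : ∀ x {w : Seq n} → FirstMixedPair w e → sgn (x ∷ swapAt (suc e) w) ≡ - sgn (x ∷ w)
sgn-swapAt {e = e} x {w} f = begin
  sgn (x ∷ w′)
    ≡⟨ cong signOf (negPosSum≡negPosSumFrom0 (x ∷ w′)) ⟩
  signOf (negPosSumFrom 0 (x ∷ w′))
    ≡⟨ signOf-OffByOne (OffByOne-+ˡ (negWeight x 1) (negPosSumFrom-swapAt 1 f)) ⟩
  - signOf (negPosSumFrom 0 (x ∷ w))
    ≡⟨ cong (-_ ∘′ signOf) (negPosSum≡negPosSumFrom0 (x ∷ w)) ⟨
  - sgn (x ∷ w)
    ∎
  where w′ = swapAt (suc e) w

-- The involution φ

phi-∷ : ∀ x {w : Seq n} → FirstMixedPair w e → phi (x ∷ w) ≡ x ∷ swapAt (suc e) w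
phi-∷ x {w} f = cong (λ j → swapAt j (x ∷ w)) (trans (eps-∷ x w) (pairEps-FirstMixedPair f))

phi-signReversingInvolution : ∀ k (b : Seq n) → InA n k b →
  InA n k (phi b) × phi (phi b) ≡ b × sgn (phi b) ≡ - sgn b
phi-signReversingInvolution k []       (_ , _ , ())
phi-signReversingInvolution k (m1 ∷ w) (ballot , _) = ⊥-elim (IsBallot⇒BallotFrom (m1 ∷ w) ballot)
phi-signReversingInvolution k (p1 ∷ w) (ballot , plus , pos)
  with firstMixedPair w (subst (0 <_) (eps-∷ p1 w) pos)
... | e , f rewrite phi-∷ p1 f | phi-∷ p1 (FirstMixedPair-swapAt f) | swapAt-involutive (suc e) w =
  (ballot′ , plus′ , pos′) , refl , sgn-swapAt p1 f
  where
  w′ = swapAt (suc e) w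
  ballot′ : IsBallot (p1 ∷ w′)
  ballot′ = BallotFrom⇒IsBallot (p1 ∷ w′)
    (BallotFrom-swapAt 0 f (IsBallot⇒BallotFrom (p1 ∷ w) ballot))
  plus′ : numPlus (p1 ∷ w′) ≡ k
  plus′ = trans (cong suc (numPlus-swapAt (suc e) w)) plus
  pos′ : 0 < eps (p1 ∷ w′)
  pos′ rewrite eps-∷ p1 w′ | pairEps-FirstMixedPair (FirstMixedPair-swapAt f) = s≤s z≤n

-- Ballot paths

-- ballotCount h m K counts the sequences of length m with K entries 1 whose partial sums stay ≥ -h.
mutual
  ballotCount : ℕ → ℕ → ℕ → ℕ
  ballotCount h zero    zero    = 1
  ballotCount h zero    (suc K) = 0
  ballotCount h (suc m) K       = ballotCountUp h m K + ballotCountDown h m K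

  ballotCountUp : ℕ → ℕ → ℕ → ℕ
  ballotCountUp h m zero    = 0
  ballotCountUp h m (suc K) = ballotCount (suc h) m K

  ballotCountDown : ℕ → ℕ → ℕ → ℕ
  ballotCountDown zero    m K = 0
  ballotCountDown (suc h) m K = ballotCount h m K

pascal-+ : ∀ a b m s k → a + m C suc s ≡ m C k → b + m C s ≡ m C suc k →
  (a + b) + suc m C suc s ≡ suc m C suc k
pascal-+ a b m s k ha hb = begin
  (a + b) + suc m C suc s          ≡⟨ cong (_+_ (a + b)) (sym (pascal m s)) ⟩
  (a + b) + (m C s + m C suc s)    ≡⟨ cong (_+_ (a + b)) (ℕ.+-comm (m C s) _) ⟩
  (a + b) + (m C suc s + m C s)    ≡⟨ interchange a b (m C suc s) (m C s) ⟩
  (a + m C suc s) + (b + m C s)    ≡⟨ cong₂ _+_ ha hb ⟩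
  m C k + m C suc k                ≡⟨ pascal m k ⟩
  suc m C suc k                    ∎

-- C(m, K+h+1) counts, by reflection in height -1, the paths from height h that go below 0.
ballotCount-reflection : ∀ h m K → m ≤ suc (h + double K) →
  ballotCount h m K + m C suc (h + K) ≡ m C K
ballotCount-reflection h       zero          zero    _ = refl
ballotCount-reflection h       zero          (suc K) _ = refl
ballotCount-reflection zero    (suc zero)    zero    _ = refl
ballotCount-reflection zero    (suc (suc m)) zero    (s≤s ())
ballotCount-reflection zero    (suc m)       (suc K) (s≤s m≤) =
  pascal-+ (ballotCount 1 m K) 0 m (suc K) K (ballotCount-reflection 1 m K m≤) refl
ballotCount-reflection (suc h) (suc m)       zero    (s≤s m≤) = begin
  b + suc m C (2 + h′)             ≡⟨ cong (_+_ b) (sym (pascal m (suc h′))) ⟩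
  b + (m C suc h′ + m C (2 + h′))  ≡⟨ cong (λ c → b + (m C suc h′ + c)) (k>n⇒nCk≡0 (s≤s m≤)) ⟩
  b + (m C suc h′ + 0)             ≡⟨ cong (_+_ b) (ℕ.+-identityʳ _) ⟩
  b + m C suc h′                   ≡⟨ ballotCount-reflection h m 0 m≤ ⟩
  1                                ∎
  where
  b  = ballotCount h m 0
  h′ = h + 0
ballotCount-reflection (suc h) (suc m)       (suc K) (s≤s m≤) =
  pascal-+ (ballotCount (2 + h) m K) (ballotCount h m (suc K)) m (suc (h + suc K)) K
    IH₁ (ballotCount-reflection h m (suc K) m≤)
  where
  IH₁ : ballotCount (2 + h) m K + m C suc (suc (h + suc K)) ≡ m C K
  IH₁ rewrite ℕ.+-suc h K = ballotCount-reflection (2 + h) m K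
    (ℕ.≤-trans m≤ (ℕ.≤-reflexive (cong suc (trans (ℕ.+-suc h _) (cong suc (ℕ.+-suc h _))))))

[1+k]*[1+n]C[1+k]≡[1+n]*nCk : ∀ n k → suc k * (suc n C suc k) ≡ suc n * (n C k)
[1+k]*[1+n]C[1+k]≡[1+n]*nCk zero    zero    = refl
[1+k]*[1+n]C[1+k]≡[1+n]*nCk zero    (suc k) = ℕ.*-zeroʳ (2 + k)
[1+k]*[1+n]C[1+k]≡[1+n]*nCk (suc n) zero    =
  trans (ℕ.*-identityˡ _) (trans (nC1≡n (2 + n)) (sym (ℕ.*-identityʳ (2 + n))))
[1+k]*[1+n]C[1+k]≡[1+n]*nCk (suc n) (suc k) = begin
  (2 + k) * ((2 + n) C (2 + k))          ≡⟨ cong (_*_ (2 + k)) (sym (pascal (suc n) (suc k))) ⟩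
  (2 + k) * (c + c′)                     ≡⟨ ℕ.*-distribˡ-+ (2 + k) c c′ ⟩
  (c + suc k * c) + (2 + k) * c′         ≡⟨ cong₂ (λ x y → (c + x) + y) IH IH′ ⟩
  (c + suc n * d) + suc n * d′           ≡⟨ ℕ.+-assoc c _ _ ⟩
  c + (suc n * d + suc n * d′)           ≡⟨ cong (_+_ c) (sym (ℕ.*-distribˡ-+ (suc n) d d′)) ⟩
  c + suc n * (d + d′)                   ≡⟨ cong (λ x → c + suc n * x) (pascal n k) ⟩
  (2 + n) * c                            ∎
  where
  c   = suc n C suc k
  c′  = suc n C (2 + k)
  d   = n C k
  d′  = n C suc k
  IH  = [1+k]*[1+n]C[1+k]≡[1+n]*nCk n k
  IH′ = [1+k]*[1+n]C[1+k]≡[1+n]*nCk n (suc k)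

-- For c = C(N,K) - C(N,K+1) this is (N+1)c = (2K-N+1)C(N+1,K+1), rearranged to avoid subtraction.
ballot-crossℕ : ∀ N K c → c + N C suc K ≡ N C K →
  suc N * c + suc N * (suc N C suc K) ≡ suc K * (suc N C suc K) + suc K * (suc N C suc K)
ballot-crossℕ N K c hyp = begin
  suc N * c + suc N * (suc N C suc K)   ≡⟨ sym (ℕ.*-distribˡ-+ (suc N) c _) ⟩
  suc N * (c + suc N C suc K)           ≡⟨ cong (λ x → suc N * (c + x)) (sym (pascal N K)) ⟩
  suc N * (c + (N C K + N C suc K))     ≡⟨ cong (_*_ (suc N)) (x∙yz≈y∙xz c (N C K) _) ⟩
  suc N * (N C K + (c + N C suc K))     ≡⟨ cong (λ x → suc N * (N C K + x)) hyp ⟩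
  suc N * (N C K + N C K)               ≡⟨ ℕ.*-distribˡ-+ (suc N) (N C K) _ ⟩
  suc N * (N C K) + suc N * (N C K)
    ≡⟨ cong (λ x → x + x) (sym ([1+k]*[1+n]C[1+k]≡[1+n]*nCk N K)) ⟩
  suc K * (suc N C suc K) + suc K * (suc N C suc K) ∎

pos-suc-* : ∀ m n → + (suc m * n) ≡ (+ m ℤ.+ + 1) ℤ.* + n
pos-suc-* m n = trans (ℤ.pos-* (suc m) n) (cong (λ x → + x ℤ.* + n) (ℕ.+-comm 1 m))

ballot-crossℤ : ∀ N K c → c + N C suc K ≡ N C K →
  + c ℤ.* + suc N ≡ (+ (2 * K) ℤ.- + N ℤ.+ + 1) ℤ.* + (suc N C suc K)
ballot-crossℤ N K c hyp = begin
  + c ℤ.* + suc N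
    ≡⟨ trans (ℤ.*-comm (+ c) _) (sym (ℤ.pos-* (suc N) c)) ⟩
  + (suc N * c)
    ≡⟨ x≡[x+y]-y (+ (suc N * c)) (+ (suc N * C′)) ⟩
  + (suc N * c) ℤ.+ + (suc N * C′) ℤ.- + (suc N * C′)
    ≡⟨ cong (ℤ._- + (suc N * C′))
            (trans (sym (ℤ.pos-+ (suc N * c) _)) (cong +_ (ballot-crossℕ N K c hyp))) ⟩
  + (suc K * C′ + suc K * C′) ℤ.- + (suc N * C′)
    ≡⟨ cong₂ ℤ._-_ (trans (ℤ.pos-+ (suc K * C′) _) (cong (λ x → x ℤ.+ x) (pos-suc-* K C′)))
                   (pos-suc-* N C′) ⟩
  ((+ K ℤ.+ + 1) ℤ.* + C′ ℤ.+ (+ K ℤ.+ + 1) ℤ.* + C′) ℤ.- (+ N ℤ.+ + 1) ℤ.* + C′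
    ≡⟨ twice-minus (+ K) (+ N) (+ C′) ⟩
  (+ K ℤ.+ + K ℤ.- + N ℤ.+ + 1) ℤ.* + C′
    ≡⟨ cong (λ x → (x ℤ.- + N ℤ.+ + 1) ℤ.* + C′) (sym pos-2*K) ⟩
  (+ (2 * K) ℤ.- + N ℤ.+ + 1) ℤ.* + C′
    ∎
  where
  C′ = suc N C suc K
  pos-2*K : + (2 * K) ≡ + K ℤ.+ + K
  pos-2*K = trans (cong (λ x → + (K + x)) (ℕ.+-identityʳ K)) (ℤ.pos-+ K K)
  x≡[x+y]-y : ∀ (x y : ℤ) → x ≡ x ℤ.+ y ℤ.- y
  x≡[x+y]-y = solve-∀
  twice-minus : ∀ (k n c : ℤ) →
    ((k ℤ.+ + 1) ℤ.* c ℤ.+ (k ℤ.+ + 1) ℤ.* c) ℤ.- (n ℤ.+ + 1) ℤ.* c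
      ≡ (k ℤ.+ k ℤ.- n ℤ.+ + 1) ℤ.* c
  twice-minus = solve-∀

toℚ≡[z/N+1]*C : ∀ N c z C → + c ℤ.* + suc N ≡ z ℤ.* + C →
  toℚ c ≡ (z ℚ./ suc N) ℚ.* (+ C ℚ./ 1)
toℚ≡[z/N+1]*C N c z C cross = ℚ.toℚᵘ-injective
  (ℚᵘ.≃-trans (ℚ.toℚᵘ-fromℚᵘ (mkℚᵘ (+ c) 0))
  (ℚᵘ.≃-trans (*≡* cross′)
  (ℚᵘ.≃-sym (ℚᵘ.≃-trans (ℚ.toℚᵘ-homo-* (z ℚ./ suc N) (+ C ℚ./ 1))
    (ℚᵘ.*-cong (ℚ.toℚᵘ-fromℚᵘ (mkℚᵘ z N)) (ℚ.toℚᵘ-fromℚᵘ (mkℚᵘ (+ C) 0)))))))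
  where
  cross′ : + c ℤ.* + suc (N * 1) ≡ (z ℤ.* + C) ℤ.* + 1
  cross′ = trans (cong (λ x → + c ℤ.* + suc x) (ℕ.*-identityʳ N))
                 (trans cross (sym (ℤ.*-identityʳ _)))

ballotNum-pascal : ∀ N K c → c + N C suc K ≡ N C K → toℚ c ≡ ballotNum N K
ballotNum-pascal N K c hyp =
  toℚ≡[z/N+1]*C N c (+ (2 * K) ℤ.- + N ℤ.+ + 1) (suc N C suc K) (ballot-crossℤ N K c hyp)

ballotCount-ballotNum : ∀ m K → m ≤ suc (double K) → toℚ (ballotCount 0 m K) ≡ ballotNum m K
ballotCount-ballotNum m K m≤ = ballotNum-pascal m K _ (ballotCount-reflection 0 m K m≤)

-- Counting A*

count : ∀ n {P : Seq n → Set} → Decidable P → ℕ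
count n P? = length (filter P? (allSeqs n))

length-filter-concatMap : ∀ {A B : Set} {P : B → Set} (P? : Decidable P) (f g : A → B) xs →
  length (filter P? (concatMap (λ a → f a ∷ g a ∷ []) xs))
    ≡ length (filter (λ a → P? (f a)) xs) + length (filter (λ a → P? (g a)) xs)
length-filter-concatMap P? f g []       = refl
length-filter-concatMap P? f g (a ∷ xs) with P? (f a)
... | yes _ with P? (g a)
...   | yes _ = cong suc (trans (cong suc (length-filter-concatMap P? f g xs)) (sym (ℕ.+-suc _ _)))
...   | no  _ = cong suc (length-filter-concatMap P? f g xs)
length-filter-concatMap P? f g (a ∷ xs) | no _ with P? (g a)
...   | yes _ = trans (cong suc (length-filter-concatMap P? f g xs)) (sym (ℕ.+-suc _ _))
...   | no  _ = length-filter-concatMap P? f g xs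

count-∷ : ∀ n {P : Seq (suc n) → Set} (P? : Decidable P) →
  count (suc n) P? ≡ count n (λ b → P? (p1 ∷ b)) + count n (λ b → P? (m1 ∷ b))
count-∷ n P? = length-filter-concatMap P? (p1 ∷_) (m1 ∷_) (allSeqs n)

count-cong : ∀ n {P Q : Seq n → Set} (P? : Decidable P) (Q? : Decidable Q) →
  (∀ b → P b → Q b) → (∀ b → Q b → P b) → count n P? ≡ count n Q?
count-cong n P? Q? P⇒Q Q⇒P =
  cong length (filter-≐ P? Q? ((λ {b} → P⇒Q b) , (λ {b} → Q⇒P b)) (allSeqs n))

count-none : ∀ n {P : Seq n → Set} (P? : Decidable P) → (∀ b → ¬ P b) → count n P? ≡ 0
count-none n P? ¬P = cong length (filter-none P? (universal ¬P (allSeqs n)))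

-- The height is counted in pairs: w starts at height 2g+1.
PairedBallot : ℕ → ℕ → Seq n → Set
PairedBallot g K w = BallotFrom (suc (double g)) w × numPlus w ≡ K × pairEps w ≡ 0

pairedBallot? : ∀ g K → Decidable (PairedBallot {n} g K)
pairedBallot? g K w =
  ballotFrom? (suc (double g)) w ×-dec (numPlus w ℕ.≟ K ×-dec (pairEps w ℕ.≟ 0))

cardAstar-∷ : ∀ n K → cardAstar (suc n) (suc K) ≡ count n (pairedBallot? 0 K)
cardAstar-∷ n K = begin
  cardAstar (suc n) (suc K)
    ≡⟨ count-∷ n (inAstar? (suc n) (suc K)) ⟩
  count n (λ b → inAstar? _ _ (p1 ∷ b)) + count n (λ b → inAstar? _ _ (m1 ∷ b))
    ≡⟨ cong₂ _+_ (count-cong n _ _ p1-tail p1-tail⁻¹)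
                 (count-none n _ λ b A → IsBallot⇒BallotFrom (m1 ∷ b) (proj₁ A)) ⟩
  count n (pairedBallot? 0 K) + 0
    ≡⟨ ℕ.+-identityʳ _ ⟩
  count n (pairedBallot? 0 K)
    ∎
  where
  p1-tail : ∀ b → InAstar (suc n) (suc K) (p1 ∷ b) → PairedBallot 0 K b
  p1-tail b (ballot , plus , eps≡0) =
    IsBallot⇒BallotFrom (p1 ∷ b) ballot , ℕ.suc-injective plus , trans (sym (eps-∷ p1 b)) eps≡0
  p1-tail⁻¹ : ∀ b → PairedBallot 0 K b → InAstar (suc n) (suc K) (p1 ∷ b)
  p1-tail⁻¹ b (ballot , plus , pairEps≡0) =
    BallotFrom⇒IsBallot (p1 ∷ b) ballot , cong suc plus , trans (eps-∷ p1 b) pairEps≡0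

pairedBallotUp : ℕ → ℕ → ℕ → ℕ
pairedBallotUp n g (suc (suc K)) = count n (pairedBallot? (suc g) K)
pairedBallotUp n g _             = 0

pairedBallotDown : ℕ → ℕ → ℕ → ℕ
pairedBallotDown n (suc g) K = count n (pairedBallot? g K)
pairedBallotDown n zero    K = 0

shift₂≡0 : ∀ j → shift₂ j ≡ 0 → j ≡ 0
shift₂≡0 zero _ = refl

count-pairedBallot-step : ∀ n g K →
  count (2 + n) (pairedBallot? g K) ≡ pairedBallotUp n g K + pairedBallotDown n g K
count-pairedBallot-step n g K = begin
  count (2 + n) P?
    ≡⟨ count-∷ (suc n) P? ⟩
  count (suc n) (P? ∘ (p1 ∷_)) + count (suc n) (P? ∘ (m1 ∷_))
    ≡⟨ cong₂ _+_ (count-∷ n (P? ∘ (p1 ∷_))) (count-∷ n (P? ∘ (m1 ∷_))) ⟩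
  (count n (P? ∘ (p1 ∷_) ∘ (p1 ∷_)) + count n (P? ∘ (p1 ∷_) ∘ (m1 ∷_))) +
  (count n (P? ∘ (m1 ∷_) ∘ (p1 ∷_)) + count n (P? ∘ (m1 ∷_) ∘ (m1 ∷_)))
    ≡⟨ cong₂ _+_ (cong₂ _+_ (up g K) (count-none n _ λ { r (_ , _ , ()) }))
                 (cong₂ _+_ (count-none n _ λ { r (_ , _ , ()) }) (down g K)) ⟩
  (pairedBallotUp n g K + 0) + (0 + pairedBallotDown n g K)
    ≡⟨ cong (_+ pairedBallotDown n g K) (ℕ.+-identityʳ _) ⟩
  pairedBallotUp n g K + pairedBallotDown n g K
    ∎
  where
  P? = pairedBallot? g K
  up : ∀ g K → count n (pairedBallot? g K ∘ (p1 ∷_) ∘ (p1 ∷_)) ≡ pairedBallotUp n g K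
  up g zero          = count-none n _ λ { r (_ , () , _) }
  up g (suc zero)    = count-none n _ λ { r (_ , () , _) }
  up g (suc (suc K)) = count-cong n _ _
    (λ r (B , plus , pairEps≡0) → B , ℕ.suc-injective (ℕ.suc-injective plus) , shift₂≡0 _ pairEps≡0)
    (λ r (B , plus , pairEps≡0) → B , cong (λ j → 2 + j) plus , cong shift₂ pairEps≡0)
  down : ∀ g K → count n (pairedBallot? g K ∘ (m1 ∷_) ∘ (m1 ∷_)) ≡ pairedBallotDown n g K
  down zero    K = count-none n _ λ { r (() , _ , _) }
  down (suc g) K = count-cong n _ _
    (λ r (B , plus , pairEps≡0) → B , plus , shift₂≡0 _ pairEps≡0)
    (λ r (B , plus , pairEps≡0) → B , plus , cong shift₂ pairEps≡0)

count-pairedBallot-even : ∀ g m K →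
  count (double m) (pairedBallot? g (double K)) ≡ ballotCount g m K
count-pairedBallot-even g zero    zero    = refl
count-pairedBallot-even g zero    (suc K) = refl
count-pairedBallot-even g (suc m) K       =
  trans (count-pairedBallot-step (double m) g (double K)) (cong₂ _+_ (up K) (down g))
  where
  up : ∀ K → pairedBallotUp (double m) g (double K) ≡ ballotCountUp g m K
  up zero    = refl
  up (suc K) = count-pairedBallot-even (suc g) m K
  down : ∀ g → pairedBallotDown (double m) g (double K) ≡ ballotCountDown g m K
  down zero    = refl
  down (suc g) = count-pairedBallot-even g m K

count-pairedBallot-odd : ∀ g m K → count (double m) (pairedBallot? g (suc (double K))) ≡ 0
count-pairedBallot-odd g zero    K = refl
count-pairedBallot-odd g (suc m) K =
  trans (count-pairedBallot-step (double m) g (suc (double K))) (cong₂ _+_ (up K) (down g))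
  where
  up : ∀ K → pairedBallotUp (double m) g (suc (double K)) ≡ 0
  up zero    = refl
  up (suc K) = count-pairedBallot-odd (suc g) m K
  down : ∀ g → pairedBallotDown (double m) g (suc (double K)) ≡ 0
  down zero    = refl
  down (suc g) = count-pairedBallot-odd g m K

-- The unpaired last entry is free, since the height before it is odd.
count-pairedBallot-last : ∀ g m K →
  count (suc (double m)) (pairedBallot? g K) ≡ ballotCount g m (K / 2)
count-pairedBallot-last g zero    zero          = refl
count-pairedBallot-last g zero    (suc zero)    = refl
count-pairedBallot-last g zero    (suc (suc K)) = sym (cong (ballotCount g 0) ([2+n]/2≡1+n/2 K))
count-pairedBallot-last g (suc m) K             =
  trans (count-pairedBallot-step (suc (double m)) g K) (cong₂ _+_ (up K) (down g))
  where
  up : ∀ K → pairedBallotUp (suc (double m)) g K ≡ ballotCountUp g m (K / 2)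
  up zero          = refl
  up (suc zero)    = refl
  up (suc (suc K)) =
    trans (count-pairedBallot-last (suc g) m K) (cong (ballotCountUp g m) (sym ([2+n]/2≡1+n/2 K)))
  down : ∀ g → pairedBallotDown (suc (double m)) g K ≡ ballotCountDown g m (K / 2)
  down zero    = refl
  down (suc g) = count-pairedBallot-last g m K

cardAstar-odd-odd : ∀ m K → m ≤ double K →
  toℚ (cardAstar (suc (double m)) (suc (double K))) ≡ ballotNum m K
cardAstar-odd-odd m K m≤2K = begin
  toℚ (cardAstar (suc (double m)) (suc (double K)))
    ≡⟨ cong toℚ (cardAstar-∷ (double m) (double K)) ⟩
  toℚ (count (double m) (pairedBallot? 0 (double K)))
    ≡⟨ cong toℚ (count-pairedBallot-even 0 m K) ⟩
  toℚ (ballotCount 0 m K)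
    ≡⟨ ballotCount-ballotNum m K (ℕ.m≤n⇒m≤1+n m≤2K) ⟩
  ballotNum m K
    ∎

cardAstar-odd-even : ∀ m K → cardAstar (suc (double m)) (2 + double K) ≡ 0
cardAstar-odd-even m K =
  trans (cardAstar-∷ (double m) (suc (double K))) (count-pairedBallot-odd 0 m K)

cardAstar-even : ∀ m k → suc m ≤ k → toℚ (cardAstar (2 + double m) k) ≡ ballotNum m ((k ∸ 1) / 2)
cardAstar-even m (suc k) (s≤s m≤k) = begin
  toℚ (cardAstar (2 + double m) (suc k))
    ≡⟨ cong toℚ (cardAstar-∷ (suc (double m)) k) ⟩
  toℚ (count (suc (double m)) (pairedBallot? 0 k))
    ≡⟨ cong toℚ (count-pairedBallot-last 0 m k) ⟩
  toℚ (ballotCount 0 m (k / 2))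
    ≡⟨ ballotCount-ballotNum m (k / 2) (ℕ.≤-trans m≤k (n≤1+double[n/2] k)) ⟩
  ballotNum m (k / 2)
    ∎

-- The views are taken as arguments: a `with` on evenOdd n would make Agda normalise the goal,
-- and normalising ballotNum exhausts memory.
cardAstar-oddLength : ∀ {n k} → EvenOdd n → EvenOdd k → (n + 1) / 2 ≤ k → n % 2 ≡ 1 →
  (k % 2 ≡ 1 → toℚ (cardAstar n k) ≡ ballotNum ((n ∸ 1) / 2) ((k ∸ 1) / 2)) ×
  (k % 2 ≡ 0 → cardAstar n k ≡ 0)
cardAstar-oddLength (even m) _ _ n-odd = ⊥-elim (ℕ.0≢1+n (trans (sym (double[m]%2≡0 m)) n-odd))
cardAstar-oddLength (odd m) (odd K) bound _ =
  (λ _ → begin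
    toℚ (cardAstar (suc (double m)) (suc (double K)))
      ≡⟨ cardAstar-odd-odd m K
           (ℕ.≤-pred (subst (_≤ suc (double K)) ([1+double[m]+1]/2≡1+m m) bound)) ⟩
    ballotNum m K
      ≡⟨ cong₂ ballotNum (double[m]/2≡m m) (double[m]/2≡m K) ⟨
    ballotNum (double m / 2) (double K / 2)
      ∎) ,
  (λ k-even → ⊥-elim (ℕ.0≢1+n (trans (sym k-even) ([1+double[m]]%2≡1 K))))
cardAstar-oddLength (odd m) (even zero) bound _ =
  ⊥-elim (ℕ.n≮0 (subst (_≤ 0) ([1+double[m]+1]/2≡1+m m) bound))
cardAstar-oddLength (odd m) (even (suc K)) _ _ =
  (λ k-odd → ⊥-elim (ℕ.0≢1+n (trans (sym (double[m]%2≡0 (suc K))) k-odd))) ,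
  (λ _ → cardAstar-odd-even m K)

cardAstar-evenLength : ∀ {n} k → EvenOdd n → 1 ≤ n → (n + 1) / 2 ≤ k → n % 2 ≡ 0 →
  toℚ (cardAstar n k) ≡ ballotNum (n / 2 ∸ 1) ((k ∸ 1) / 2)
cardAstar-evenLength k (odd m)        _  _     n-even =
  ⊥-elim (ℕ.0≢1+n (trans (sym n-even) ([1+double[m]]%2≡1 m)))
cardAstar-evenLength k (even zero)    () _     _
cardAstar-evenLength k (even (suc m)) _  bound _      = begin
  toℚ (cardAstar (2 + double m) k)
    ≡⟨ cardAstar-even m k (subst (_≤ k) ([double[1+m]+1]/2≡1+m m) bound) ⟩
  ballotNum m ((k ∸ 1) / 2)
    ≡⟨ cong (λ x → ballotNum (x ∸ 1) ((k ∸ 1) / 2)) (double[m]/2≡m (suc m)) ⟨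
  ballotNum (double (suc m) / 2 ∸ 1) ((k ∸ 1) / 2)
    ∎

proposition3p1 : (n k : ℕ) → 1 ≤ n → (n + 1) / 2 ≤ k → k ≤ n →
    ((b : Seq n) → InA n k b →
        InA n k (phi b) × phi (phi b) ≡ b × sgn (phi b) ≡ - sgn b)
    × (n % 2 ≡ 1 →
        (k % 2 ≡ 1 → toℚ (cardAstar n k) ≡ ballotNum ((n ∸ 1) / 2) ((k ∸ 1) / 2))
        × (k % 2 ≡ 0 → cardAstar n k ≡ 0))
    × (n % 2 ≡ 0 →
        toℚ (cardAstar n k) ≡ ballotNum (n / 2 ∸ 1) ((k ∸ 1) / 2))
proposition3p1 n k 1≤n bound _ =
  phi-signReversingInvolution k ,
  cardAstar-oddLength (evenOdd n) (evenOdd k) bound ,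
  cardAstar-evenLength k (evenOdd n) 1≤n bound
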